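{- Let $G=(V,E)$ be a finite simple undirected graph and let $(L,S,R)$ be a minimum vertex cut of $G$. Then $L$ has neighborhood difference at most $2|L|$, i.e., $|N_G(u)\triangle N_G(v)|\le 2|L|$ for all $u,v\in L$.
   Context: $N_G(u)$ denotes the set of neighbors of $u$ and $A\triangle B=(A\setminus B)\cup(B\setminus A)$. A vertex cut of $G$ (with $n=|V|$) is a partition $(L,S,R)$ of $V$ such that either $L\neq\emptyset$, $R\neq\emptyset$ and there is no edge between $L$ and $R$, or $|S|\ge n-1$; its size is $|S|$, and a minimum vertex cut is one of minimum size. A vertex set $X$ has neighborhood difference $d$ if $|N_G(u)\triangle N_G(v)|\le d$ for all $u,v\in X$. -}

module Defs where

open import Data.Nat using (ℕ; _≤_; _∸_)
open import Data.Bool using (Bool; true; false; _xor_)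
open import Data.Fin using (Fin)
open import Data.Fin.Subset using (Subset; ∣_∣)
open import Data.Vec using (tabulate)
open import Data.Product using (_×_; ∃-syntax)
open import Data.Sum using (_⊎_)
open import Relation.Binary.PropositionalEquality using (_≡_)

record SimpleGraph (n : ℕ) : Set where
  field
    adj    : Fin n → Fin n → Bool
    sym    : ∀ u v → adj u v ≡ adj v u
    irrefl : ∀ v → adj v v ≡ false
open SimpleGraph public

count : ∀ {n} → (Fin n → Bool) → ℕ
count p = ∣ tabulate p ∣

nbhdDiff : ∀ {n} → SimpleGraph n → Fin n → Fin n → ℕ
nbhdDiff G u v = count (λ w → adj G u w xor adj G v w)

data Part : Set where
  inL inS inR : Part

Partition : ℕ → Set
Partition n = Fin n → Part

isL isS isR : Part → Bool
isL inL = true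
isL _   = false
isS inS = true
isS _   = false
isR inR = true
isR _   = false

cutSize : ∀ {n} → Partition n → ℕ
cutSize P = count (λ v → isS (P v))

IsVertexCut : ∀ {n} → SimpleGraph n → Partition n → Set
IsVertexCut {n} G P =
  ((∃[ l ] P l ≡ inL) × (∃[ r ] P r ≡ inR)
     × (∀ u v → P u ≡ inL → P v ≡ inR → adj G u v ≡ false))
  ⊎ (n ∸ 1 ≤ cutSize P)

IsMinVertexCut : ∀ {n} → SimpleGraph n → Partition n → Set
IsMinVertexCut {n} G P =
  IsVertexCut G P × (∀ (Q : Partition n) → IsVertexCut G Q → cutSize P ≤ cutSize Q)

{-# OPTIONS --safe #-}
module Submission where

-- For u ∈ L every neighbour lies in L ∪ S, and ({u}, N(u), V ∖ N[u]) is a vertex cut (R is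
-- nonempty and misses N[u]), so minimality gives |S| ≤ |N(u)|.  Hence u is non-adjacent to at
-- most |L ∪ S| − |N(u)| ≤ |L| vertices of L ∪ S, and N(u) △ N(v) consists of vertices of L ∪ S
-- missed by u or by v, so it has at most 2|L| elements.  In the degenerate case |S| ≥ n − 1,
-- L has at most one vertex, so u = v.

open import Defs hiding (sym)
open import Data.Nat using (suc; _≤_; _<_; _*_; _+_; _∸_; z≤n; s≤s)
open import Data.Nat.Properties
  using (≤-trans; ≤-reflexive; ≤-<-trans; <⇒≱; n≤1+n; +-suc; +-comm; +-identityʳ;
         +-mono-≤; +-monoʳ-≤; +-cancelʳ-≤; ∸-cancelʳ-≤; module ≤-Reasoning)
open import Data.Bool using (Bool; true; false; _xor_; if_then_else_)
open import Data.Bool.Properties using (xor-same)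
open import Data.Fin using (Fin; _≟_)
open import Data.Fin.Subset using (Subset; inside; outside; ∣_∣; _∈_; _∉_; _⊆_; _∪_; _∩_; _─_; ∁; Empty)
open import Data.Fin.Subset.Properties
  using (p⊆q⇒∣p∣≤∣q∣; ∣p∣≤n; ∣∁p∣≡n∸∣p∣; ∣⊥∣≡0; Empty-unique; x∈p∪q⁺; x∈p∩q⁺;
         x∈p∧x∉q⇒x∈p─q; x∈p∧x≢y⇒x∈p-y; x∈p⇒∣p-x∣<∣p∣; x∉p⇒x∈∁p)
open import Data.Vec using ([]; _∷_; tabulate)
open import Data.Vec.Properties using (lookup∘tabulate; []=⇒lookup; lookup⇒[]=)
open import Data.Product using (_,_)
open import Data.Sum using (inj₁; inj₂)
open import Data.Empty using (⊥-elim)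
open import Function using (case_of_)
open import Relation.Nullary using (yes; no; does)
open import Relation.Nullary.Decidable using (dec-true; dec-false)
open import Relation.Binary.PropositionalEquality using (_≡_; _≢_; refl; sym; trans; cong; subst)

∣p∣≡∣p∩q∣+∣p─q∣ : ∀ {n} (p q : Subset n) → ∣ p ∣ ≡ ∣ p ∩ q ∣ + ∣ p ─ q ∣
∣p∣≡∣p∩q∣+∣p─q∣ []            []            = refl
∣p∣≡∣p∩q∣+∣p─q∣ (inside  ∷ p) (inside  ∷ q) = cong suc (∣p∣≡∣p∩q∣+∣p─q∣ p q)
∣p∣≡∣p∩q∣+∣p─q∣ (inside  ∷ p) (outside ∷ q) =
  trans (cong suc (∣p∣≡∣p∩q∣+∣p─q∣ p q)) (sym (+-suc _ _))
∣p∣≡∣p∩q∣+∣p─q∣ (outside ∷ p) (inside  ∷ q) = ∣p∣≡∣p∩q∣+∣p─q∣ p q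
∣p∣≡∣p∩q∣+∣p─q∣ (outside ∷ p) (outside ∷ q) = ∣p∣≡∣p∩q∣+∣p─q∣ p q

∣p∪q∣≤∣p∣+∣q∣ : ∀ {n} (p q : Subset n) → ∣ p ∪ q ∣ ≤ ∣ p ∣ + ∣ q ∣
∣p∪q∣≤∣p∣+∣q∣ []            []            = z≤n
∣p∪q∣≤∣p∣+∣q∣ (inside  ∷ p) (inside  ∷ q) =
  s≤s (≤-trans (∣p∪q∣≤∣p∣+∣q∣ p q) (+-monoʳ-≤ ∣ p ∣ (n≤1+n ∣ q ∣)))
∣p∪q∣≤∣p∣+∣q∣ (inside  ∷ p) (outside ∷ q) = s≤s (∣p∪q∣≤∣p∣+∣q∣ p q)
∣p∪q∣≤∣p∣+∣q∣ (outside ∷ p) (inside  ∷ q) =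
  ≤-trans (s≤s (∣p∪q∣≤∣p∣+∣q∣ p q)) (≤-reflexive (sym (+-suc ∣ p ∣ ∣ q ∣)))
∣p∪q∣≤∣p∣+∣q∣ (outside ∷ p) (outside ∷ q) = ∣p∪q∣≤∣p∣+∣q∣ p q

∣p∪q─r∣≤∣p∣ : ∀ {n} {p q r : Subset n} → r ⊆ p ∪ q → ∣ q ∣ ≤ ∣ r ∣ → ∣ p ∪ q ─ r ∣ ≤ ∣ p ∣
∣p∪q─r∣≤∣p∣ {p = p} {q} {r} r⊆p∪q ∣q∣≤∣r∣ = +-cancelʳ-≤ ∣ q ∣ _ _ (begin
  ∣ p ∪ q ─ r ∣ + ∣ q ∣            ≤⟨ +-monoʳ-≤ ∣ p ∪ q ─ r ∣ (≤-trans ∣q∣≤∣r∣ ∣r∣≤∣p∪q∩r∣) ⟩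
  ∣ p ∪ q ─ r ∣ + ∣ (p ∪ q) ∩ r ∣  ≡⟨ +-comm ∣ p ∪ q ─ r ∣ _ ⟩
  ∣ (p ∪ q) ∩ r ∣ + ∣ p ∪ q ─ r ∣  ≡⟨ sym (∣p∣≡∣p∩q∣+∣p─q∣ (p ∪ q) r) ⟩
  ∣ p ∪ q ∣                        ≤⟨ ∣p∪q∣≤∣p∣+∣q∣ p q ⟩
  ∣ p ∣ + ∣ q ∣                    ∎)
  where
  open ≤-Reasoning
  ∣r∣≤∣p∪q∩r∣ : ∣ r ∣ ≤ ∣ (p ∪ q) ∩ r ∣
  ∣r∣≤∣p∪q∩r∣ = p⊆q⇒∣p∣≤∣q∣ (λ x∈r → x∈p∩q⁺ (r⊆p∪q x∈r , x∈r))

∣p∣≤1∧x∈p∧y∈p⇒x≡y : ∀ {n} {p : Subset n} {x y} → ∣ p ∣ ≤ 1 → x ∈ p → y ∈ p → x ≡ y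
∣p∣≤1∧x∈p∧y∈p⇒x≡y {p = p} {x} {y} ∣p∣≤1 x∈p y∈p with x ≟ y
... | yes x≡y = x≡y
... | no  x≢y = ⊥-elim (<⇒≱ 1<∣p∣ ∣p∣≤1)
  where
  1<∣p∣ : 1 < ∣ p ∣
  1<∣p∣ = ≤-<-trans (≤-<-trans z≤n (x∈p⇒∣p-x∣<∣p∣ (x∈p∧x≢y⇒x∈p-y x∈p x≢y))) (x∈p⇒∣p-x∣<∣p∣ y∈p)

module _ {n} {f : Fin n → Bool} {x : Fin n} where

  ∈-tabulate⁺ : f x ≡ true → x ∈ tabulate f
  ∈-tabulate⁺ fx = lookup⇒[]= x (tabulate f) (trans (lookup∘tabulate f x) fx)

  ∈-tabulate⁻ : x ∈ tabulate f → f x ≡ true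
  ∈-tabulate⁻ x∈f = trans (sym (lookup∘tabulate f x)) ([]=⇒lookup x∈f)

  ∉-tabulate⁺ : f x ≡ false → x ∉ tabulate f
  ∉-tabulate⁺ fx x∈f = case trans (sym fx) (∈-tabulate⁻ x∈f) of λ ()

tabulate-xor⊆ : ∀ {n} {f g : Fin n → Bool} {m : Subset n} → tabulate f ⊆ m → tabulate g ⊆ m →
  tabulate (λ x → f x xor g x) ⊆ (m ─ tabulate f) ∪ (m ─ tabulate g)
tabulate-xor⊆ {f = f} {g} f⊆m g⊆m {x} x∈f⊕g with f x in fx | g x in gx | ∈-tabulate⁻ x∈f⊕g
... | true  | false | _ = x∈p∪q⁺ (inj₂ (x∈p∧x∉q⇒x∈p─q (f⊆m (∈-tabulate⁺ fx)) (∉-tabulate⁺ gx)))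
... | false | true  | _ = x∈p∪q⁺ (inj₁ (x∈p∧x∉q⇒x∈p─q (g⊆m (∈-tabulate⁺ gx)) (∉-tabulate⁺ fx)))
... | true  | true  | ()
... | false | false | ()

module _ {n} (G : SimpleGraph n) where

  nbhd : Fin n → Subset n
  nbhd u = tabulate (adj G u)

  nbhdDiff-self : ∀ u → nbhdDiff G u u ≡ 0
  nbhdDiff-self u = trans (cong ∣_∣ (Empty-unique Δ-empty)) (∣⊥∣≡0 n)
    where
    Δ-empty : Empty (tabulate (λ w → adj G u w xor adj G u w))
    Δ-empty (x , x∈Δ) = ∉-tabulate⁺ (xor-same (adj G u x)) x∈Δ

  nbhdDiff≤∣m─nbhd∣+∣m─nbhd∣ : ∀ {m : Subset n} {u v} → nbhd u ⊆ m → nbhd v ⊆ m →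
    nbhdDiff G u v ≤ ∣ m ─ nbhd u ∣ + ∣ m ─ nbhd v ∣
  nbhdDiff≤∣m─nbhd∣+∣m─nbhd∣ {m} {u} {v} Nu⊆m Nv⊆m =
    ≤-trans (p⊆q⇒∣p∣≤∣q∣ (tabulate-xor⊆ Nu⊆m Nv⊆m)) (∣p∪q∣≤∣p∣+∣q∣ (m ─ nbhd u) (m ─ nbhd v))

  nbhdCut : Fin n → Partition n
  nbhdCut u w = if does (w ≟ u) then inL else if adj G u w then inS else inR

  module _ {u : Fin n} where

    nbhdCut-inL : ∀ {x} → nbhdCut u x ≡ inL → x ≡ u
    nbhdCut-inL {x} eq with x ≟ u | adj G u x
    ... | yes x≡u | _     = x≡u
    ... | no  _   | true  = case eq of λ ()
    ... | no  _   | false = case eq of λ ()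

    nbhdCut-inS : ∀ {x} → nbhdCut u x ≡ inS → adj G u x ≡ true
    nbhdCut-inS {x} eq with x ≟ u | adj G u x
    ... | yes _ | _     = case eq of λ ()
    ... | no  _ | true  = refl
    ... | no  _ | false = case eq of λ ()

    nbhdCut-inR : ∀ {x} → nbhdCut u x ≡ inR → adj G u x ≡ false
    nbhdCut-inR {x} eq with x ≟ u | adj G u x
    ... | yes _ | _     = case eq of λ ()
    ... | no  _ | true  = case eq of λ ()
    ... | no  _ | false = refl

    nbhdCut-isVertexCut : ∀ {r} → r ≢ u → adj G u r ≡ false → IsVertexCut G (nbhdCut u)
    nbhdCut-isVertexCut {r} r≢u u≁r = inj₁ ((u , u∈L) , (r , r∈R) , noEdge)
      where
      u∈L : nbhdCut u u ≡ inL
      u∈L rewrite dec-true (u ≟ u) refl = refl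
      r∈R : nbhdCut u r ≡ inR
      r∈R rewrite dec-false (r ≟ u) r≢u | u≁r = refl
      noEdge : ∀ x y → nbhdCut u x ≡ inL → nbhdCut u y ≡ inR → adj G x y ≡ false
      noEdge x y x∈L y∈R with refl ← nbhdCut-inL {x} x∈L = nbhdCut-inR y∈R

    cutSize-nbhdCut : cutSize (nbhdCut u) ≤ ∣ nbhd u ∣
    cutSize-nbhdCut = p⊆q⇒∣p∣≤∣q∣ S⊆nbhd
      where
      isS-true : ∀ {p} → isS p ≡ true → p ≡ inS
      isS-true {inS} _ = refl
      S⊆nbhd : tabulate (λ w → isS (nbhdCut u w)) ⊆ nbhd u
      S⊆nbhd x∈S = ∈-tabulate⁺ (nbhdCut-inS (isS-true (∈-tabulate⁻ {f = λ w → isS (nbhdCut u w)} x∈S)))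

module _ {n} (P : Partition n) where

  L S : Subset n
  L = tabulate (λ w → isL (P w))
  S = tabulate (λ w → isS (P w))

  ∈L⁺ : ∀ {x} → P x ≡ inL → x ∈ L
  ∈L⁺ Px≡inL = ∈-tabulate⁺ (cong isL Px≡inL)

  ∈S⁺ : ∀ {x} → P x ≡ inS → x ∈ S
  ∈S⁺ Px≡inS = ∈-tabulate⁺ (cong isS Px≡inS)

  S⊆∁L : S ⊆ ∁ L
  S⊆∁L {x} x∈S = x∉p⇒x∈∁p (∉-tabulate⁺ (isS⇒¬isL (∈-tabulate⁻ x∈S)))
    where
    isS⇒¬isL : ∀ {p} → isS p ≡ true → isL p ≡ false
    isS⇒¬isL {inS} _ = refl

  n∸1≤cutSize⇒∣L∣≤1 : n ∸ 1 ≤ cutSize P → ∣ L ∣ ≤ 1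
  n∸1≤cutSize⇒∣L∣≤1 n∸1≤∣S∣ = ∸-cancelʳ-≤ (∣p∣≤n L) (begin
    n ∸ 1     ≤⟨ n∸1≤∣S∣ ⟩
    ∣ S ∣     ≤⟨ p⊆q⇒∣p∣≤∣q∣ S⊆∁L ⟩
    ∣ ∁ L ∣   ≡⟨ ∣∁p∣≡n∸∣p∣ L ⟩
    n ∸ ∣ L ∣ ∎)
    where open ≤-Reasoning

module _ {n} (G : SimpleGraph n) (P : Partition n) where

  Separated : Set
  Separated = ∀ x y → P x ≡ inL → P y ≡ inR → adj G x y ≡ false

  nbhd⊆L∪S : Separated → ∀ {u} → P u ≡ inL → nbhd G u ⊆ L P ∪ S P
  nbhd⊆L∪S separated {u} u∈L {x} x∈N with P x in Px
  ... | inL = x∈p∪q⁺ (inj₁ (∈L⁺ P Px))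
  ... | inS = x∈p∪q⁺ (inj₂ (∈S⁺ P Px))
  ... | inR = case trans (sym (∈-tabulate⁻ x∈N)) (separated u x u∈L Px) of λ ()

  cutSize≤∣nbhd∣ : IsMinVertexCut G P → ∀ {u r} → r ≢ u → adj G u r ≡ false →
    cutSize P ≤ ∣ nbhd G u ∣
  cutSize≤∣nbhd∣ (_ , minimal) r≢u u≁r =
    ≤-trans (minimal _ (nbhdCut-isVertexCut G r≢u u≁r)) (cutSize-nbhdCut G)

  ∣L∪S─nbhd∣≤∣L∣ : IsMinVertexCut G P → Separated → ∀ {u r} → P u ≡ inL → P r ≡ inR →
    ∣ L P ∪ S P ─ nbhd G u ∣ ≤ ∣ L P ∣
  ∣L∪S─nbhd∣≤∣L∣ minCut separated {u} {r} u∈L r∈R =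
    ∣p∪q─r∣≤∣p∣ (nbhd⊆L∪S separated u∈L) (cutSize≤∣nbhd∣ minCut r≢u (separated u r u∈L r∈R))
    where
    r≢u : r ≢ u
    r≢u refl = case trans (sym r∈R) u∈L of λ ()

lemma3p1 : ∀ {n} (G : SimpleGraph n) (P : Partition n) → IsMinVertexCut G P →
    ∀ (u v : Fin n) → P u ≡ inL → P v ≡ inL →
    nbhdDiff G u v ≤ 2 * count (λ w → isL (P w))
lemma3p1 G P minCut@(inj₁ (_ , (r , r∈R) , separated) , _) u v u∈L v∈L = begin
  nbhdDiff G u v
    ≤⟨ nbhdDiff≤∣m─nbhd∣+∣m─nbhd∣ G (nbhd⊆L∪S G P separated u∈L) (nbhd⊆L∪S G P separated v∈L) ⟩
  ∣ L P ∪ S P ─ nbhd G u ∣ + ∣ L P ∪ S P ─ nbhd G v ∣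
    ≤⟨ +-mono-≤ (∣L∪S─nbhd∣≤∣L∣ G P minCut separated u∈L r∈R)
                (∣L∪S─nbhd∣≤∣L∣ G P minCut separated v∈L r∈R) ⟩
  ∣ L P ∣ + ∣ L P ∣
    ≡⟨ cong (∣ L P ∣ +_) (sym (+-identityʳ ∣ L P ∣)) ⟩
  2 * ∣ L P ∣ ∎
  where open ≤-Reasoning
lemma3p1 G P (inj₂ n∸1≤cutSize , _) u v u∈L v∈L
  with refl ← ∣p∣≤1∧x∈p∧y∈p⇒x≡y (n∸1≤cutSize⇒∣L∣≤1 P n∸1≤cutSize) (∈L⁺ P u∈L) (∈L⁺ P v∈L) =
  subst (_≤ _) (sym (nbhdDiff-self G u)) z≤n
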